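{- Let $\to_0$ and $\to_1$ be binary relations. Set $\to_2\;:=\;\to_0^*\circ\to_1$ and $\to_3\;:=\;\to_0\cup\to_1$. Let $a\in\mathrm{dom}(\to_3)$, and let $a'$ be a $\to_3$-normal form of $a$. Set $A:=\{b : a\to_3^* b\}$ and $\to_4\;:=\;\{(b,c)\in\to_3 : b\in A\}$. Suppose the following four conditions hold. 1. The relation $\{(c,b) : b\to_0 c,\ b\in A\}$ is well-founded. 2. There is $n\in\mathbb N$ with the following property. For every $m\in\mathbb N$ and every sequence $b_0,\dots,b_m$ with $b_0=a$, $b_i\to_2 b_{i+1}$ for each $i\in\{0,\dots,m-1\}$, and $b_m\to_0^* a'$, we have $m\le n$. 3. For all $b_1,b_2$: if there is $c$ with $c\to_4 b_1$ and $c\to_1 b_2$, then there is $d$ with $b_1\to_4^* d$ and $b_2\to_4^* d$. 4. For all $b_1,b_2$: if there is $c$ with $c\to_4 b_1$ and $c\to_0 b_2$, then there is $d$ with $b_1\to_4^* d$ and either $b_2=d$ or $b_2\to_4 d$. Then the reverse relation $\{(c,b): b\to_4 c\}$ is well-founded.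
   Context: For a binary relation $R$: - $R^*$ denotes its reflexive transitive closure. - $\mathrm{dom}(R)=\{a:\exists b.\,(a,b)\in R\}$. - The composition $R\circ S$ is $\{(a,c): \exists b.\ (a,b)\in R,\ (b,c)\in S\}$. An element $a'$ is an $R$-normal form of $a$ iff $a R^* a'$ and $a'\notin\mathrm{dom}(R)$. A relation $R$ is well-founded iff every non-empty class $B$ has an $R$-minimal element, i.e. some $a\in B$ such that there is no $a'\in B$ with $a' R\, a$. -}

module Defs where

open import Level using (Level; _⊔_)
open import Data.Nat using (ℕ; suc; _≤_)
open import Data.Fin using (Fin; zero; suc; inject₁; fromℕ)
open import Data.Product using (Σ; ∃; _×_)
open import Data.Sum using (_⊎_)
open import Relation.Nullary using (¬_)
open import Relation.Binary.Core using (Rel)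
open import Relation.Binary.PropositionalEquality using (_≡_)
open import Relation.Binary.Construct.Closure.ReflexiveTransitive using (Star)

module _ {a : Level} {X : Set a} where

  _⨾_ : Rel X a → Rel X a → Rel X a
  _⨾_ R S x z = Σ X λ y → R x y × S y z

  _∪ᵣ_ : Rel X a → Rel X a → Rel X a
  (R ∪ᵣ S) x y = R x y ⊎ S x y

  Dom : Rel X a → X → Set _
  Dom R x = Σ X λ y → R x y

  IsNormalForm : Rel X a → X → X → Set _
  IsNormalForm R x x' = Star R x x' × ¬ Dom R x'

  Rev : Rel X a → Rel X a
  Rev R c b = R b c

  Restrict : Rel X a → (X → Set a) → Rel X a
  Restrict R P b c = R b c × P b

  IsChain : Rel X a → (m : ℕ) → (Fin (suc m) → X) → Set a
  IsChain R m b = (i : Fin m) → R (b (inject₁ i)) (b (suc i))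

-- Call b convergent if it is accessible for the reverse of →₄ and each of its
-- →₄-reducts still reduces to a'. If b reduces to a' and all its →₄-successors
-- that reduce to a' are convergent, then b is convergent: for b →₄ c, the
-- reduction of b to a' starts with some b →₄ e, local confluence (conditions 3
-- and 4) joins c and e at some d, and as e is convergent, d and hence c reduce
-- to a'. So a is convergent by well-founded induction on (n ∸ k , b) ordered
-- lexicographically, where k counts the →₁-steps on a way from a to b: a
-- →₀-step keeps k and descends in the order of condition 1, while a →₁-step
-- increases k, which condition 2 keeps at most n as long as a' is reachable.
module Submission where

open import Defs
open import Level using (Level)
open import Data.Nat using (ℕ; suc; _≤_; _<_; _∸_)
open import Data.Nat.Properties using (n≤1+n; n<1+n; ≤-trans; ∸-monoʳ-<)
open import Data.Nat.Induction using (<-wellFounded)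
open import Data.Fin using (Fin; zero; suc; fromℕ)
open import Data.Product using (Σ; _×_; _,_; proj₁; proj₂)
open import Data.Product.Relation.Binary.Lex.Strict using (×-Lex; ×-wellFounded)
open import Data.Sum using (_⊎_; inj₁; inj₂)
open import Data.Empty using (⊥-elim)
open import Function using (_on_)
open import Relation.Nullary using (¬_)
open import Relation.Binary.Core using (Rel)
open import Relation.Binary.PropositionalEquality using (_≡_; refl; sym; subst)
open import Relation.Binary.Construct.Closure.ReflexiveTransitive
  using (Star; ε; _◅_; _◅◅_; return; map)
import Relation.Binary.Construct.On as On
open import Induction.WellFounded using (WellFounded; Acc; acc)

module _ {a : Level} {X : Set a} where

  data Chain (R : Rel X a) : X → ℕ → X → Set a where
    []  : ∀ {s} → Chain R s 0 s
    _∷_ : ∀ {s t k u} → R s t → Chain R t k u → Chain R s (suc k) u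

  module _ {R : Rel X a} where

    _∷ʳ_ : ∀ {s k t u} → Chain R s k t → R t u → Chain R s (suc k) u
    []       ∷ʳ r = r ∷ []
    (q ∷ qs) ∷ʳ r = q ∷ (qs ∷ʳ r)

    vertices : ∀ {s k t} → Chain R s k t → Fin (suc k) → X
    vertices {s} _        zero    = s
    vertices     []       (suc ())
    vertices     (_ ∷ qs) (suc i) = vertices qs i

    vertices-last : ∀ {s k t} (qs : Chain R s k t) → vertices qs (fromℕ k) ≡ t
    vertices-last []       = refl
    vertices-last (_ ∷ qs) = vertices-last qs

    vertices-isChain : ∀ {s k t} (qs : Chain R s k t) → IsChain R k (vertices qs)
    vertices-isChain (q ∷ [])       zero    = q
    vertices-isChain (q ∷ (r ∷ qs)) zero    = q
    vertices-isChain (_ ∷ qs)       (suc i) = vertices-isChain qs i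

    star-restrict : ∀ {P : X → Set a} → (∀ {b c} → R b c → P b → P c) →
                    ∀ {b c} → P b → Star R b c → Star (Restrict R P) b c
    star-restrict P-closed Pb ε       = ε
    star-restrict P-closed Pb (r ◅ q) = (r , Pb) ◅ star-restrict P-closed (P-closed r Pb) q

    acc-star : ∀ {b c} → Acc (Rev R) b → Star R b c → Acc (Rev R) c
    acc-star acc-b    ε       = acc-b
    acc-star (acc rs) (r ◅ q) = acc-star (rs r) q

  module Convergence {R : Rel X a}
    (locally-confluent : ∀ {b c e} → R b c → R b e → Σ X λ d → Star R c d × Star R e d)
    {z : X} (z-normal : ¬ Dom R z) where

    ConvergesTo : X → Set a
    ConvergesTo b = Acc (Rev R) b × (∀ {c} → Star R b c → Star R c z)

    reduct-reaches : ∀ {b c} → Star R b z →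
                     (∀ {e} → R b e → Star R e z → ConvergesTo e) →
                     R b c → Star R c z
    reduct-reaches ε       _  r = ⊥-elim (z-normal (_ , r))
    reduct-reaches (s ◅ p) ih r with locally-confluent r s
    ... | d , c→d , e→d = c→d ◅◅ proj₂ (ih s p) e→d

    converges-of-successors : ∀ {b} → Star R b z →
                              (∀ {c} → R b c → Star R c z → ConvergesTo c) →
                              ConvergesTo b
    converges-of-successors {b} p ih = acc (λ r → proj₁ (ih r (reaches r))) , reducts-reach
      where
      reaches : ∀ {c} → R b c → Star R c z
      reaches = reduct-reaches p ih

      reducts-reach : ∀ {c} → Star R b c → Star R c z
      reducts-reach ε       = p
      reducts-reach (r ◅ q) = proj₂ (ih r (reaches r)) q

module _ {a : Level} {X : Set a} (R₀ R₁ : Rel X a) (x x' : X) where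

  R₂ : Rel X a
  R₂ = Star R₀ ⨾ R₁

  R₃ : Rel X a
  R₃ = R₀ ∪ᵣ R₁

  A : X → Set a
  A = Star R₃ x

  R₄ : Rel X a
  R₄ = Restrict R₃ A

  A-closed : ∀ {b c} → R₃ b c → A b → A c
  A-closed r x→b = x→b ◅◅ return r

  R₄-locally-confluent :
    (∀ b₁ b₂ → Σ X (λ c → R₄ c b₁ × R₁ c b₂) → Σ X (λ d → Star R₄ b₁ d × Star R₄ b₂ d)) →
    (∀ b₁ b₂ → Σ X (λ c → R₄ c b₁ × R₀ c b₂) → Σ X (λ d → Star R₄ b₁ d × (b₂ ≡ d ⊎ R₄ b₂ d))) →
    ∀ {b c e} → R₄ b c → R₄ b e → Σ X λ d → Star R₄ c d × Star R₄ e d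
  R₄-locally-confluent join₁ join₀ {b} r (inj₂ s , _) = join₁ _ _ (b , r , s)
  R₄-locally-confluent join₁ join₀ {b} r (inj₁ s , _) with join₀ _ _ (b , r , s)
  ... | d , c→d , inj₁ refl = d , c→d , ε
  ... | d , c→d , inj₂ e→d  = d , c→d , return e→d

  -- b is reached from x by an R₃-path with exactly k R₁-steps.
  Reach : ℕ → X → Set a
  Reach k b = Σ X λ y → Chain R₂ x k y × Star R₀ y b

  reach-R₀ : ∀ {k b c} → Reach k b → R₀ b c → Reach k c
  reach-R₀ (y , qs , y→b) r = y , qs , y→b ◅◅ return r

  reach-R₁ : ∀ {k b c} → Reach k b → R₁ b c → Reach (suc k) c
  reach-R₁ {b = b} (y , qs , y→b) r = _ , qs ∷ʳ (b , y→b , r) , ε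

  module _ {n : ℕ}
    (bounded : (m : ℕ) (b : Fin (suc m) → X) → b zero ≡ x → IsChain R₂ m b →
               Star R₀ (b (fromℕ m)) x' → m ≤ n) where

    reach-bounded : ∀ {k b} → Reach k b → Star R₃ b x' → k ≤ n
    reach-bounded {k} (y , qs , y→x') ε =
      bounded k (vertices qs) refl (vertices-isChain qs)
        (subst (λ v → Star R₀ v x') (sym (vertices-last qs)) y→x')
    reach-bounded rb (inj₁ r ◅ q) = reach-bounded (reach-R₀ rb r) q
    reach-bounded rb (inj₂ r ◅ q) = ≤-trans (n≤1+n _) (reach-bounded (reach-R₁ rb r) q)

    _≺_ : Rel (ℕ × X) a
    _≺_ = ×-Lex _≡_ (_<_ on (n ∸_)) (Rev (Restrict R₀ A))

    ≺-wellFounded : WellFounded (Rev (Restrict R₀ A)) → WellFounded _≺_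
    ≺-wellFounded wf₀ = ×-wellFounded (On.wellFounded (n ∸_) <-wellFounded) wf₀

    reach-descends : ∀ {k b c} → Reach k b → R₄ b c → Star R₄ c x' →
                     Σ ℕ λ k' → Reach k' c × (k' , c) ≺ (k , b)
    reach-descends rb (inj₁ r , x→b) _ = _ , reach-R₀ rb r , inj₂ (refl , r , x→b)
    reach-descends rb (inj₂ r , _)   q =
      _ , reach-R₁ rb r , inj₁ (∸-monoʳ-< (n<1+n _) (reach-bounded (reach-R₁ rb r) (map proj₁ q)))

    module _
      (wf₀ : WellFounded (Rev (Restrict R₀ A)))
      (join₁ : ∀ b₁ b₂ → Σ X (λ c → R₄ c b₁ × R₁ c b₂) → Σ X (λ d → Star R₄ b₁ d × Star R₄ b₂ d))
      (join₀ : ∀ b₁ b₂ → Σ X (λ c → R₄ c b₁ × R₀ c b₂) →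
                         Σ X (λ d → Star R₄ b₁ d × (b₂ ≡ d ⊎ R₄ b₂ d)))
      (x'-normal : ¬ Dom R₃ x') where

      open Convergence (R₄-locally-confluent join₁ join₀) {x'} (λ (c , r , _) → x'-normal (c , r))

      reach-converges : ∀ {k b} → Acc _≺_ (k , b) → Reach k b → Star R₄ b x' → ConvergesTo b
      reach-converges (acc rs) rb p = converges-of-successors p λ r q →
        let _ , rc , descent = reach-descends rb r q in reach-converges (rs descent) rc q

      Rev-R₄-wellFounded : Star R₃ x x' → WellFounded (Rev R₄)
      Rev-R₄-wellFounded x→x' _ = acc λ (r , x→b) →
        acc-star x-acc (star-restrict A-closed ε (x→b ◅◅ return r))
        where
        x-acc : Acc (Rev R₄) x
        x-acc = proj₁ (reach-converges (≺-wellFounded wf₀ (0 , x)) (x , [] , ε)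
                                       (star-restrict A-closed ε x→x'))

theorem2p2 : ∀ {a : Level} {X : Set a} (R₀ R₁ : Rel X a) (x x' : X) →
    let R₂ = Star R₀ ⨾ R₁
        R₃ = R₀ ∪ᵣ R₁
        A = Star R₃ x
        R₄ = Restrict R₃ A
    in Dom R₃ x →
       IsNormalForm R₃ x x' →
       WellFounded (Rev (Restrict R₀ A)) →
       Σ ℕ (λ n → (m : ℕ) (b : Fin (suc m) → X) → b zero ≡ x → IsChain R₂ m b →
                  Star R₀ (b (fromℕ m)) x' → m ≤ n) →
       (∀ b₁ b₂ → Σ X (λ c → R₄ c b₁ × R₁ c b₂) →
                  Σ X (λ d → Star R₄ b₁ d × Star R₄ b₂ d)) →
       (∀ b₁ b₂ → Σ X (λ c → R₄ c b₁ × R₀ c b₂) →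
                  Σ X (λ d → Star R₄ b₁ d × (b₂ ≡ d ⊎ R₄ b₂ d))) →
       WellFounded (Rev R₄)
theorem2p2 R₀ R₁ x x' _ (x→x' , x'-normal) wf₀ (_ , bounded) join₁ join₀ =
  Rev-R₄-wellFounded R₀ R₁ x x' bounded wf₀ join₁ join₀ x'-normal x→x'
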